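{- For every $a, b \in \Lambda_{\mathrm{dB}}$ and $i \in \mathbb{N}_{>0}$ such that $i+1 \notin \mathrm{FV}(a)$ and $i \notin \mathrm{FV}(b)$, we have $\mathrm{dec}_i(a[b]) = \mathrm{dec}_{i+1}(a)\big[\mathrm{dec}_i(b)\big]$ (both sides being defined).
   Context: $\Lambda_{\mathrm{dB}}$ is the set of de Bruijn terms given by $a ::= n \mid a\,a \mid \lambda a$ with $n \in \mathbb{N}_{>0}$. For $N\subseteq\mathbb{N}$, $N-1=\{n-1 : n\in N, n>1\}$. Free variables: $\mathrm{FV}(n)=\{n\}$, $\mathrm{FV}(a\,b)=\mathrm{FV}(a)\cup\mathrm{FV}(b)$, $\mathrm{FV}(\lambda a)=\mathrm{FV}(a)-1$. Increment: for $i\in\mathbb{N}$, $\mathrm{inc}_i(n)=n$ if $n\le i$ and $n+1$ if $n>i$; $\mathrm{inc}_i(a\,b)=\mathrm{inc}_i(a)\,\mathrm{inc}_i(b)$; $\mathrm{inc}_i(\lambda a)=\lambda\,\mathrm{inc}_{i+1}(a)$. Swap: for $i\in\mathbb{N}_{>0}$, $\mathrm{sw}_i(n)=n$ if $n<i$ or $n>i+1$, $\mathrm{sw}_i(i)=i+1$, $\mathrm{sw}_i(i+1)=i$; $\mathrm{sw}_i(a\,b)=\mathrm{sw}_i(a)\,\mathrm{sw}_i(b)$; $\mathrm{sw}_i(\lambda a)=\lambda\,\mathrm{sw}_{i+1}(a)$. $\lambda r$ meta-substitution $a[c]$: $1[c]=c$, $n[c]=n-1$ for $n>1$; $(a\,b)[c]=a[c]\,b[c]$;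 $(\lambda a)[c]=\lambda\big(\mathrm{sw}_1(a)[\mathrm{inc}_0(c)]\big)$. Decrement (a partial operator): for $i\in\mathbb{N}_{>0}$, $\mathrm{dec}_i(n)=n$ if $n<i$, undefined if $n=i$, $n-1$ if $n>i$; $\mathrm{dec}_i(a\,b)=\mathrm{dec}_i(a)\,\mathrm{dec}_i(b)$; $\mathrm{dec}_i(\lambda a)=\lambda\,\mathrm{dec}_{i+1}(a)$. $\mathrm{dec}_i(a)$ is defined iff $i\notin\mathrm{FV}(a)$. -}

module Defs where

open import Data.Nat using (ℕ; zero; suc; NonZero; _≤ᵇ_; _≡ᵇ_; _+_; compare; less; equal; greater)
open import Data.Bool using (if_then_else_)
open import Data.Maybe using (Maybe; just; nothing)

data Λ : Set where
  var : (n : ℕ) → .{{NonZero n}} → Λ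
  app : Λ → Λ → Λ
  lam : Λ → Λ

data _∈FV_ : ℕ → Λ → Set where
  fv-var  : ∀ {n} .{{_ : NonZero n}} → n ∈FV var n
  fv-appˡ : ∀ {n a b} → n ∈FV a → n ∈FV app a b
  fv-appʳ : ∀ {n a b} → n ∈FV b → n ∈FV app a b
  fv-lam  : ∀ {n a} .{{_ : NonZero n}} → suc n ∈FV a → n ∈FV lam a

inc : ℕ → Λ → Λ
inc i (var n) = if n ≤ᵇ i then var n else var (suc n)
inc i (app a b) = app (inc i a) (inc i b)
inc i (lam a) = lam (inc (suc i) a)

swVar : (j n : ℕ) → .{{NonZero n}} → Λ
swVar j n = if n ≡ᵇ suc j then var (suc (suc j))
            else (if n ≡ᵇ suc (suc j) then var (suc j) else var n)

sw : (i : ℕ) → .{{NonZero i}} → Λ → Λ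
sw (suc j) (var n) = swVar j n
sw (suc j) (app a b) = app (sw (suc j) a) (sw (suc j) b)
sw (suc j) (lam a) = lam (sw (suc (suc j)) a)

size : Λ → ℕ
size (var n) = 1
size (app a b) = suc (size a + size b)
size (lam a) = suc (size a)

-- The recursive call on sw_1(a) is not structural, so we recurse on fuel;
-- sw preserves size, so fuel = size a always suffices (the zero-fuel clause is never reached).
substF : ℕ → Λ → Λ → Λ
substF zero a c = a
substF (suc f) (var (suc zero)) c = c
substF (suc f) (var (suc (suc k))) c = var (suc k)
substF (suc f) (app a b) c = app (substF f a c) (substF f b c)
substF (suc f) (lam a) c = lam (substF f (sw 1 a) (inc 0 c))

subst : Λ → Λ → Λ
subst a c = substF (size a) a c

dec : (i : ℕ) → .{{NonZero i}} → Λ → Maybe Λ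
dec (suc j) (var (suc m)) with compare m j
... | less _ _ = just (var (suc m))
... | equal _ = nothing
... | greater _ k = just (var (suc (j + k)))
dec (suc j) (app a b) with dec (suc j) a | dec (suc j) b
... | just a' | just b' = just (app a' b')
... | _ | _ = nothing
dec (suc j) (lam a) with dec (suc (suc j)) a
... | just a' = just (lam a')
... | nothing = nothing

-- Decrementing is partial, so we work with its graph, which exists whenever
-- the removed index is not free.  Under a binder a[c] substitutes inc_0 c into
-- sw_1 a, and the removed index i becomes i+1 on the body; the graph is
-- preserved by sw_1 and inc_0 because they only move indices below the removed
-- one.  Decrementing preserves size, so both sides of the equation run
-- substF on the same fuel.
module Submission where

open import Defs
open import Data.Nat
  using (ℕ; zero; suc; NonZero; _+_; _≤_; _<_; _≤ᵇ_; _≡ᵇ_; z≤n; s≤s; s<s; s<s⁻¹; compare; less; equal; greater)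
open import Data.Nat.Properties
  using (<-cmp; <-irrefl; <-trans; <-asym; ≤-refl; ≤-trans; <-≤-trans; ≤-reflexive; m≤m+n; m≤n+m; m<n⇒m<1+n; m≤n⇒m≤1+n; n<1+n; n≤1+n; <⇒≱; >⇒≢; ≤ᵇ⇒≤; ≡ᵇ⇒≡)
open import Data.Bool using (true; false)
open import Data.Maybe using (just)
open import Data.Product using (∃; ∃₂; _×_; _,_)
open import Data.Empty using (⊥-elim)
open import Relation.Nullary using (¬_)
open import Relation.Binary.Definitions using (tri<; tri≈; tri>)
open import Relation.Binary.PropositionalEquality using (_≡_; refl; cong; cong₂)

-- j ⊢ a ↓ a′ is the graph of dec_(suc j).
data _⊢_↓_ (j : ℕ) : Λ → Λ → Set where
  var< : ∀ {m} → m < j → j ⊢ var (suc m) ↓ var (suc m)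
  var> : ∀ {m} → j ≤ m → j ⊢ var (suc (suc m)) ↓ var (suc m)
  app  : ∀ {a a′ b b′} → j ⊢ a ↓ a′ → j ⊢ b ↓ b′ → j ⊢ app a b ↓ app a′ b′
  lam  : ∀ {a a′} → suc j ⊢ a ↓ a′ → j ⊢ lam a ↓ lam a′

dec-var< : ∀ {j m} → m < j → dec (suc j) (var (suc m)) ≡ just (var (suc m))
dec-var< {j} {m} m<j with compare m j
... | less _ _    = refl
... | equal _     = ⊥-elim (<-irrefl refl m<j)
... | greater _ k = ⊥-elim (<-asym m<j (s≤s (m≤m+n j k)))

dec-var> : ∀ {j m} → j ≤ m → dec (suc j) (var (suc (suc m))) ≡ just (var (suc m))
dec-var> {j} {m} j≤m with compare (suc m) j
... | less _ k    = ⊥-elim (<⇒≱ (s≤s (≤-trans (n≤1+n m) (m≤m+n (suc m) k))) j≤m)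
... | equal _     = ⊥-elim (<⇒≱ ≤-refl j≤m)
... | greater _ _ = refl

↓-sound : ∀ {j a a′} → j ⊢ a ↓ a′ → dec (suc j) a ≡ just a′
↓-sound (var< m<j) = dec-var< m<j
↓-sound (var> j≤m) = dec-var> j≤m
↓-sound (app da db) rewrite ↓-sound da | ↓-sound db = refl
↓-sound (lam da) rewrite ↓-sound da = refl

↓-total : ∀ {j} a → ¬ (suc j ∈FV a) → ∃ (j ⊢ a ↓_)
↓-total {j} (var (suc m)) ∉a with <-cmp m j
... | tri< m<j _ _        = _ , var< m<j
... | tri≈ _ refl _       = ⊥-elim (∉a fv-var)
... | tri> _ _ (s≤s j≤m) = _ , var> j≤m
↓-total (app a b) ∉ab with ↓-total a (λ j∈a → ∉ab (fv-appˡ j∈a))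
                        | ↓-total b (λ j∈b → ∉ab (fv-appʳ j∈b))
... | a′ , da | b′ , db = app a′ b′ , app da db
↓-total (lam a) ∉λa with ↓-total a (λ j∈a → ∉λa (fv-lam j∈a))
... | a′ , da = lam a′ , lam da

↓-size : ∀ {j a a′} → j ⊢ a ↓ a′ → size a′ ≡ size a
↓-size (var< _)    = refl
↓-size (var> _)    = refl
↓-size (app da db) = cong₂ (λ x y → suc (x + y)) (↓-size da) (↓-size db)
↓-size (lam da)    = cong suc (↓-size da)

size-sw : ∀ k a → size (sw (suc k) a) ≡ size a
size-sw k (var n) with n ≡ᵇ suc k
... | true = refl
... | false with n ≡ᵇ suc (suc k)
...   | true  = refl
...   | false = refl
size-sw k (app a b) = cong₂ (λ x y → suc (x + y)) (size-sw k a) (size-sw k b)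
size-sw k (lam a) = cong suc (size-sw (suc k) a)

swVar-above : ∀ k n → suc k < n → swVar k (suc n) ≡ var (suc n)
swVar-above k n k+1<n with n ≡ᵇ k | ≡ᵇ⇒≡ n k
... | true  | n≡k = ⊥-elim (>⇒≢ (<-trans (n<1+n k) k+1<n) (n≡k _))
... | false | _ with n ≡ᵇ suc k | ≡ᵇ⇒≡ n (suc k)
...   | true  | n≡k+1 = ⊥-elim (>⇒≢ k+1<n (n≡k+1 _))
...   | false | _     = refl

↓-swVar-below : ∀ {j k m} → suc k < j → m < j → j ⊢ swVar k (suc m) ↓ swVar k (suc m)
↓-swVar-below {k = k} {m} k+1<j m<j with m ≡ᵇ k
... | true = var< k+1<j
... | false with m ≡ᵇ suc k
...   | true  = var< (<-trans (n<1+n k) k+1<j)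
...   | false = var< m<j

↓-sw : ∀ {j a a′} k → suc k < j → j ⊢ a ↓ a′ → j ⊢ sw (suc k) a ↓ sw (suc k) a′
↓-sw k k+1<j (var< m<j) = ↓-swVar-below k+1<j m<j
↓-sw k k+1<j (var> {m} j≤m)
  rewrite swVar-above k (suc m) (m<n⇒m<1+n (<-≤-trans k+1<j j≤m))
        | swVar-above k m (<-≤-trans k+1<j j≤m) = var> j≤m
↓-sw k k+1<j (app da db) = app (↓-sw k k+1<j da) (↓-sw k k+1<j db)
↓-sw k k+1<j (lam da)    = lam (↓-sw (suc k) (s<s k+1<j) da)

inc-var-above : ∀ {k} n → k ≤ n → inc k (var (suc n)) ≡ var (suc (suc n))
inc-var-above {k} n k≤n with suc n ≤ᵇ k | ≤ᵇ⇒≤ (suc n) k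
... | true  | n<k = ⊥-elim (<⇒≱ (n<k _) k≤n)
... | false | _   = refl

↓-inc : ∀ {j k b b′} → k ≤ j → j ⊢ b ↓ b′ → suc j ⊢ inc k b ↓ inc k b′
↓-inc {k = k} k≤j (var< {m} m<j) with suc m ≤ᵇ k
... | true  = var< (m<n⇒m<1+n m<j)
... | false = var< (s<s m<j)
↓-inc k≤j (var> {m} j≤m)
  rewrite inc-var-above (suc m) (m≤n⇒m≤1+n (≤-trans k≤j j≤m))
        | inc-var-above m (≤-trans k≤j j≤m) = var> (s≤s j≤m)
↓-inc k≤j (app da db) = app (↓-inc k≤j da) (↓-inc k≤j db)
↓-inc k≤j (lam da)    = lam (↓-inc (s≤s k≤j) da)

↓-substF : ∀ {j a a′ b b′} f → size a ≤ f → suc j ⊢ a ↓ a′ → j ⊢ b ↓ b′ →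
  j ⊢ substF f a b ↓ substF f a′ b′
↓-substF zero () (var< _) _
↓-substF zero () (var> _) _
↓-substF zero () (app _ _) _
↓-substF zero () (lam _) _
↓-substF (suc f) _ (var< {zero} _) db = db
↓-substF (suc f) _ (var< {suc m} m+1<j+1) _ = var< (s<s⁻¹ m+1<j+1)
↓-substF (suc f) _ (var> (s≤s j≤m)) _ = var> j≤m
↓-substF (suc f) (s≤s sa+sb≤f) (app da₁ da₂) db =
  app (↓-substF f (≤-trans (m≤m+n _ _) sa+sb≤f) da₁ db)
      (↓-substF f (≤-trans (m≤n+m _ _) sa+sb≤f) da₂ db)
↓-substF (suc f) (s≤s sa≤f) (lam {a} da) db =
  lam (↓-substF f (≤-trans (≤-reflexive (size-sw 0 a)) sa≤f)
                  (↓-sw 0 (s<s (s<s z≤n)) da)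
                  (↓-inc z≤n db))

↓-subst : ∀ {j a a′ b b′} → suc j ⊢ a ↓ a′ → j ⊢ b ↓ b′ → j ⊢ subst a b ↓ subst a′ b′
↓-subst da db rewrite ↓-size da = ↓-substF _ ≤-refl da db

lemma19 : ∀ (a b : Λ) (i : ℕ) .{{_ : NonZero i}} →
    ¬ (suc i ∈FV a) → ¬ (i ∈FV b) →
    ∃₂ λ (a′ b′ : Λ) → dec (suc i) a ≡ just a′ × dec i b ≡ just b′ ×
      dec i (subst a b) ≡ just (subst a′ b′)
lemma19 a b (suc j) ∉a ∉b with ↓-total a ∉a | ↓-total b ∉b
... | a′ , da | b′ , db = a′ , b′ , ↓-sound da , ↓-sound db , ↓-sound (↓-subst da db)
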